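{- Let $(G,S)$ and $(H,S)$ be two compatible $d$-labeled graphs such that $\mathbf{Aux}(G,S)\oplus\mathbf{Aux}(H,S)$ has no cycles. If $F$ is an $S$-block of $(G,S)\oplus(H,S)$, then $\mathbf{Aux}(F\cap G,S\cap V(F))\oplus\mathbf{Aux}(F\cap H,S\cap V(F))$ has no cycles.
   Context: For graphs $G_1,G_2$, $G_1\cap G_2$ is the graph with vertex set $V(G_1)\cap V(G_2)$ and edge set $E(G_1)\cap E(G_2)$. A graph is biconnected if it is connected and has no cut vertex; a block is a maximal biconnected subgraph. For a graph $G$ all of whose blocks have at most $d$ vertices, a block $d$-labeling is a map $L:V(G)\to\{1,\dots,d\}$ injective on the vertex set of every block; a $d$-labeled graph is a graph with such a labeling. A boundaried graph is a pair $(G,S)$ with $S\subseteq V(G)$. Two $d$-labeled boundaried graphs $(G,S)$ and $(H,S)$ are compatible if $V(G-S)\cap V(H-S)=\emptyset$, $G[S]=H[S]$, and $G$ and $H$ have the same labels on $S$. Their sum $(G,S)\oplus(H,S)$ is the graph obtained from the disjoint union of $G$ and $H$ by identifying each vertex of $S$ in $G$ with the same vertex in $H$ and removing duplicate edges inside $S$. An $S$-block of $G$ is a block of $G$ containing an edge of $G[S]$. For a boundaried graph $(G,S)$, $\mathbf{Aux}(G,S)$ is the bipartite graph with bipartition $(\mathcal{X},\mathcal{Y})$, where $\mathcal{X}$ is the set of connected components of $G$ and $\mathcal{Y}$ the set of connected components of $G[S]$, with $C_1\in\mathcal{X}$ adjacent to $C_2\in\mathcal{Y}$ iff $C_2\subseteq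 C_1$; when $G[S]=H[S]$, $\mathbf{Aux}(G,S)\oplus\mathbf{Aux}(H,S)$ is obtained by gluing $\mathbf{Aux}(G,S)$ and $\mathbf{Aux}(H,S)$ along their common vertex set $\mathcal{Y}$ (components of $G$ and of $H$ being distinct vertices). -}

module Defs where

open import Data.Nat using (ℕ; suc; _<_; _≤_; _∸_)
open import Data.Fin using (Fin)
open import Data.List using (List)
open import Data.List.Membership.Propositional using (_∈_)
open import Data.Product using (_×_; _,_; ∃; Σ; proj₁; proj₂)
open import Data.Sum using (_⊎_; inj₁; inj₂)
open import Data.Empty using (⊥)
open import Relation.Nullary using (¬_)
open import Relation.Binary.PropositionalEquality using (_≡_; _≢_)

-- Vertex sets are predicates on a common universe ℕ of vertex names.
-- (Sharing names is exactly how the boundary S is identified in a sum.)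

VSet : Set₁
VSet = ℕ → Set

_⊆_ : VSet → VSet → Set
A ⊆ B = ∀ {v} → A v → B v

_∩ˢ_ : VSet → VSet → VSet
(A ∩ˢ B) v = A v × B v

record Graph : Set₁ where
  field
    V     : VSet
    E     : ℕ → ℕ → Set
    E-sym : ∀ {u v} → E u v → E v u
    E-irr : ∀ {u} → ¬ E u u
    E-V   : ∀ {u v} → E u v → V u × V v
open Graph public

Finite : Graph → Set
Finite G = ∃ λ (l : List ℕ) → ∀ {v} → V G v → v ∈ l

_∩ᴳ_ : Graph → Graph → Graph
G₁ ∩ᴳ G₂ = record
  { V     = V G₁ ∩ˢ V G₂
  ; E     = λ u v → E G₁ u v × E G₂ u v
  ; E-sym = λ { (e₁ , e₂) → E-sym G₁ e₁ , E-sym G₂ e₂ }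
  ; E-irr = λ { (e₁ , _) → E-irr G₁ e₁ }
  ; E-V   = λ { (e₁ , e₂) → (proj₁ (E-V G₁ e₁) , proj₁ (E-V G₂ e₂))
                          , (proj₂ (E-V G₁ e₁) , proj₂ (E-V G₂ e₂)) }
  }

-- For compatible
-- boundaried graphs this is exactly the sum (G,S) ⊕ (H,S): the vertices
-- of S are identified (same name) and duplicate edges inside S merge.
_∪ᴳ_ : Graph → Graph → Graph
G₁ ∪ᴳ G₂ = record
  { V     = λ v → V G₁ v ⊎ V G₂ v
  ; E     = λ u v → E G₁ u v ⊎ E G₂ u v
  ; E-sym = λ { (inj₁ e) → inj₁ (E-sym G₁ e) ; (inj₂ e) → inj₂ (E-sym G₂ e) }
  ; E-irr = λ { (inj₁ e) → E-irr G₁ e ; (inj₂ e) → E-irr G₂ e }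
  ; E-V   = λ { (inj₁ e) → inj₁ (proj₁ (E-V G₁ e)) , inj₁ (proj₂ (E-V G₁ e))
              ; (inj₂ e) → inj₂ (proj₁ (E-V G₂ e)) , inj₂ (proj₂ (E-V G₂ e)) }
  }

_[_] : Graph → VSet → Graph
G [ S ] = record
  { V     = V G ∩ˢ S
  ; E     = λ u v → E G u v × S u × S v
  ; E-sym = λ { (e , su , sv) → E-sym G e , sv , su }
  ; E-irr = λ { (e , _) → E-irr G e }
  ; E-V   = λ { (e , su , sv) → (proj₁ (E-V G e) , su) , (proj₂ (E-V G e) , sv) }
  }

_─_ : Graph → ℕ → Graph
G ─ x = record
  { V     = λ v → V G v × v ≢ x
  ; E     = λ u v → E G u v × u ≢ x × v ≢ x
  ; E-sym = λ { (e , ux , vx) → E-sym G e , vx , ux }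
  ; E-irr = λ { (e , _) → E-irr G e }
  ; E-V   = λ { (e , ux , vx) → (proj₁ (E-V G e) , ux) , (proj₂ (E-V G e) , vx) }
  }

data Path (G : Graph) : ℕ → ℕ → Set where
  here : ∀ {u} → V G u → Path G u u
  step : ∀ {u v w} → E G u v → Path G v w → Path G u w

Connected : Graph → Set
Connected G = (∃ λ v → V G v) × (∀ {u v} → V G u → V G v → Path G u v)

-- Cut vertex: removal disconnects two remaining vertices
-- (i.e. increases the number of connected components).
IsCutVertex : Graph → ℕ → Set
IsCutVertex G x = V G x × ∃ λ u → ∃ λ v →
  V (G ─ x) u × V (G ─ x) v × ¬ Path (G ─ x) u v

Biconnected : Graph → Set
Biconnected G = Connected G × (∀ x → ¬ IsCutVertex G x)

Subgraph : Graph → Graph → Set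
Subgraph F G = (V F ⊆ V G) × (∀ {u v} → E F u v → E G u v)

IsBlock : Graph → Graph → Set₁
IsBlock F G = Subgraph F G × Biconnected F ×
  (∀ F' → Subgraph F' G → Biconnected F' → Subgraph F F' → Subgraph F' F)

IsSBlock : Graph → VSet → Graph → Set₁
IsSBlock F S G = IsBlock F G × ∃ λ u → ∃ λ v → S u × S v × E F u v

IsBlockLabeling : (d : ℕ) → Graph → (ℕ → Fin d) → Set₁
IsBlockLabeling d G L = ∀ B → IsBlock B G →
  ∀ {u v} → V B u → V B v → L u ≡ L v → u ≡ v

Compatible : (d : ℕ) → Graph → (ℕ → Fin d) → Graph → (ℕ → Fin d) → VSet → Set
Compatible d G LG H LH S =
  (S ⊆ V G) × (S ⊆ V H) ×
  (∀ {v} → V G v → ¬ S v → V H v → ¬ S v → ⊥) ×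
  (∀ {u v} → S u → S v → (E G u v → E H u v) × (E H u v → E G u v)) ×
  (∀ {v} → S v → LG v ≡ LH v)

-- Aux(G,S) ⊕ Aux(H,S).  A connected component is represented by any of
-- its vertices; two representatives denote the same vertex of Aux iff
-- they are joined by a path in the relevant graph.

data AuxV : Set where
  X₁ : ℕ → AuxV   -- component of G (represented by a vertex)
  X₂ : ℕ → AuxV   -- component of H
  Y  : ℕ → AuxV   -- component of G[S] (= H[S])

AuxEq : Graph → Graph → VSet → AuxV → AuxV → Set
AuxEq G H S (X₁ x) (X₁ y) = Path G x y
AuxEq G H S (X₂ x) (X₂ y) = Path H x y
AuxEq G H S (Y s)  (Y t)  = Path (G [ S ]) s t
AuxEq G H S _      _      = ⊥

-- adjacency: component C₁ of G (or H) ~ component C₂ of G[S] iff C₂ ⊆ C₁,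
-- i.e. the representative of C₂ lies in S and in the component of C₁.
AuxAdj : Graph → Graph → VSet → AuxV → AuxV → Set
AuxAdj G H S (X₁ x) (Y s)  = S s × Path G x s
AuxAdj G H S (X₂ x) (Y s)  = S s × Path H x s
AuxAdj G H S (Y s)  (X₁ x) = S s × Path G x s
AuxAdj G H S (Y s)  (X₂ x) = S s × Path H x s
AuxAdj G H S _      _      = ⊥

AuxHasCycle : Graph → Graph → VSet → Set
AuxHasCycle G H S = Σ ℕ λ k → Σ (ℕ → AuxV) λ c →
  (3 ≤ k) ×
  (∀ i → suc i < k → AuxAdj G H S (c i) (c (suc i))) ×
  AuxAdj G H S (c (k ∸ 1)) (c 0) ×
  (∀ i j → i < k → j < k → AuxEq G H S (c i) (c j) → i ≡ j)

AuxAcyclic : Graph → Graph → VSet → Set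
AuxAcyclic G H S = ¬ AuxHasCycle G H S

module Submission where

-- The whole argument rests on one classical fact about blocks:
--
--   (★) if F is a block of U and K is a subgraph of U, every walk of K
--       between two vertices of F is a walk of F ∩ K.
--
-- For (★) we shorten the walk to a simple path p and show that F together
-- with p (and the U-edges among these vertices) is still biconnected: a
-- vertex x of p cuts p into two pieces, one of which still reaches an
-- end of p, and F itself has no cut vertex.  Maximality of F then puts p
-- inside F.
--
-- By (★), the restriction (F ∩ G, F ∩ H, S ∩ V F) of (G, H, S) to a block
-- F of G ∪ H is "path-closed": boundary vertices joined in G, in H or in
-- G[S] are already joined in the restricted graphs.  For any path-closed
-- restriction a cycle of the restricted Aux-sum is a cycle of the
-- original one (adjacency is inherited, and distinctness is reflected
-- because every vertex of the cycle meets the restricted boundary).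

open import Defs
open import Data.Nat using (ℕ; suc; _<_; _∸_)
open import Data.Nat.Properties using (_≟_; _<?_; ≮⇒≥; ≤-antisym)
open import Data.Fin using (Fin)
open import Data.List using (List; []; _∷_)
open import Data.List.Membership.Propositional using (_∈_)
open import Data.List.Membership.DecPropositional _≟_ using (_∈?_)
open import Data.List.Relation.Unary.Any using (here; there)
open import Data.List.Relation.Unary.All using ([]; _∷_)
open import Data.List.Relation.Unary.All.Properties using (¬Any⇒All¬; All¬⇒¬Any)
open import Data.List.Relation.Unary.Unique.Propositional using (Unique; []; _∷_; tail)
open import Data.Product using (_×_; _,_; Σ-syntax; proj₁; proj₂)
open import Data.Sum using (_⊎_; inj₁; inj₂)
open import Function using (_∘_)
open import Relation.Nullary using (¬_; yes; no)
open import Relation.Nullary.Decidable using (¬¬-excluded-middle)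
open import Relation.Binary.PropositionalEquality using (_≢_; refl; sym; subst)

infixr 5 _++ᵖ_

_++ᵖ_ : ∀ {G a b c} → Path G a b → Path G b c → Path G a c
here _ ++ᵖ q = q
step e p ++ᵖ q = step e (p ++ᵖ q)

reverse : ∀ {G : Graph} {a b} → Path G a b → Path G b a
reverse (here v) = here v
reverse {G} (step e p) = reverse p ++ᵖ step (E-sym G e) (here (proj₁ (E-V G e)))

mapPath : ∀ {A B : Graph} → Subgraph A B → ∀ {a b} → Path A a b → Path B a b
mapPath A⊆B (here v) = here (proj₁ A⊆B v)
mapPath A⊆B (step e p) = step (proj₂ A⊆B e) (mapPath A⊆B p)

startVertex : ∀ {G : Graph} {a b} → Path G a b → V G a
startVertex (here v) = v
startVertex {G} (step e _) = proj₁ (E-V G e)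

endVertex : ∀ {G : Graph} {a b} → Path G a b → V G b
endVertex (here v) = v
endVertex (step _ p) = endVertex p

vertices : ∀ {G a b} → Path G a b → List ℕ
vertices (here {u} _) = u ∷ []
vertices (step {u} _ p) = u ∷ vertices p

start∈ : ∀ {G a b} (p : Path G a b) → a ∈ vertices p
start∈ (here _) = here refl
start∈ (step _ _) = here refl

∈vertices⇒V : ∀ {G : Graph} {a b w} (p : Path G a b) → w ∈ vertices p → V G w
∈vertices⇒V (here v) (here refl) = v
∈vertices⇒V p@(step _ _) (here refl) = startVertex p
∈vertices⇒V (step _ p) (there w∈p) = ∈vertices⇒V p w∈p

Within : ∀ {G a b} → VSet → Path G a b → Set
Within P p = ∀ {w} → w ∈ vertices p → P w

transport : ∀ {K T : Graph} (P : VSet) →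
  (∀ {v} → P v → V T v) → (∀ {v w} → P v → P w → E K v w → E T v w) →
  ∀ {a b} (p : Path K a b) → Within P p → Path T a b
transport P inT edgeT (here _) inP = here (inT (inP (here refl)))
transport P inT edgeT (step e p) inP =
  step (edgeT (inP (here refl)) (inP (there (start∈ p))) e)
       (transport P inT edgeT p (inP ∘ there))

Simple : ∀ {G a b} → Path G a b → Set
Simple p = Unique (vertices p)

suffix : ∀ {G a b w} (p : Path G a b) → w ∈ vertices p →
  Σ[ q ∈ Path G w b ] Within (_∈ vertices p) q × (Simple p → Simple q)
suffix p@(here _) (here refl) = p , (λ w∈ → w∈) , (λ s → s)
suffix p@(step _ _) (here refl) = p , (λ w∈ → w∈) , (λ s → s)
suffix (step e p) (there w∈p) =
  let (q , q⊆p , simple) = suffix p w∈p in q , there ∘ q⊆p , simple ∘ tail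

simplify : ∀ {G a b} → Path G a b → Σ[ p ∈ Path G a b ] Simple p
simplify (here v) = here v , [] ∷ []
simplify {a = a} (step e q) with simplify q
... | p , simple with a ∈? vertices p
...   | yes a∈p = let (r , _ , r-simple) = suffix p a∈p in r , r-simple simple
...   | no a∉p = step e p , ¬Any⇒All¬ _ a∉p ∷ simple

OnAvoiding : ∀ {G a b} → Path G a b → ℕ → VSet
OnAvoiding p x v = v ∈ vertices p × v ≢ x

avoid : ∀ {G a b w} x (p : Path G a b) → Simple p → w ∈ vertices p → w ≢ x →
  (Σ[ q ∈ Path G w b ] Within (OnAvoiding p x) q) ⊎
  (Σ[ q ∈ Path G a w ] Within (OnAvoiding p x) q)
avoid x p@(here v) _ (here refl) w≢x = inj₂ (here v , λ { (here refl) → start∈ p , w≢x })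
avoid x p@(step _ _) _ (here refl) w≢x =
  inj₂ (here (startVertex p) , λ { (here refl) → start∈ p , w≢x })
avoid {a = a} x (step e p) (a∉p ∷ simple) (there w∈p) w≢x with a ≟ x
... | yes refl =
  let (q , q⊆p , _) = suffix p w∈p
  in inj₁ (q , λ v∈q → there (q⊆p v∈q) , λ { refl → All¬⇒¬Any a∉p (q⊆p v∈q) })
... | no a≢x with avoid x p simple w∈p w≢x
...   | inj₁ (q , ok) = inj₁ (q , λ v∈q → there (proj₁ (ok v∈q)) , proj₂ (ok v∈q))
...   | inj₂ (q , ok) = inj₂ (step e q , λ
        { (here refl) → here refl , a≢x
        ; (there v∈q) → there (proj₁ (ok v∈q)) , proj₂ (ok v∈q) })

─-mono : ∀ {A B : Graph} {x} → Subgraph A B → Subgraph (A ─ x) (B ─ x)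
─-mono A⊆B = (λ (v , v≢x) → proj₁ A⊆B v , v≢x)
           , (λ (e , u≢x , v≢x) → proj₂ A⊆B e , u≢x , v≢x)

─-absent : ∀ {G : Graph} {x} → ¬ V G x → Subgraph G (G ─ x)
─-absent {G} {x} x∉G = (λ v → v , ≢x v)
                     , (λ e → e , ≢x (proj₁ (E-V G e)) , ≢x (proj₂ (E-V G e)))
  where
  ≢x : ∀ {v} → V G v → v ≢ x
  ≢x v refl = x∉G v

∩-induced : ∀ {F G : Graph} {S : VSet} →
  Subgraph (F ∩ᴳ (G [ S ])) ((F ∩ᴳ G) [ S ∩ˢ V F ])
∩-induced {F} = (λ (vF , vG , s) → (vF , vG) , s , vF)
              , (λ (eF , eG , su , sv) →
                   (eF , eG) , (su , proj₁ (E-V F eF)) , (sv , proj₂ (E-V F eF)))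

module BlockAbsorption {U F : Graph} (block : IsBlock F U) where

  F⊆U : Subgraph F U
  F⊆U = proj₁ block

  F-joined : ∀ {a b} → V F a → V F b → Path F a b
  F-joined = proj₂ (proj₁ (proj₁ (proj₂ block)))

  F-noCut : ∀ x → ¬ IsCutVertex F x
  F-noCut = proj₂ (proj₁ (proj₂ block))

  F-maximal : ∀ F′ → Subgraph F′ U → Biconnected F′ → Subgraph F F′ → Subgraph F′ F
  F-maximal = proj₂ (proj₂ block)

  module Extension {K : Graph} (K⊆U : Subgraph K U) {u t : ℕ}
                   (p : Path K u t) (simple : Simple p) (uF : V F u) (tF : V F t) where

    InF⁺ : VSet
    InF⁺ v = V F v ⊎ v ∈ vertices p

    F⁺ : Graph
    F⁺ = record
      { V     = InF⁺
      ; E     = λ a b → E F a b ⊎ (E U a b × InF⁺ a × InF⁺ b)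
      ; E-sym = λ { (inj₁ e) → inj₁ (E-sym F e)
                  ; (inj₂ (e , a∈ , b∈)) → inj₂ (E-sym U e , b∈ , a∈) }
      ; E-irr = λ { (inj₁ e) → E-irr F e ; (inj₂ (e , _)) → E-irr U e }
      ; E-V   = λ { (inj₁ e) → inj₁ (proj₁ (E-V F e)) , inj₁ (proj₂ (E-V F e))
                  ; (inj₂ (_ , a∈ , b∈)) → a∈ , b∈ }
      }

    F⁺⊆U : Subgraph F⁺ U
    F⁺⊆U = (λ { (inj₁ vF) → proj₁ F⊆U vF ; (inj₂ v∈p) → proj₁ K⊆U (∈vertices⇒V p v∈p) })
         , (λ { (inj₁ e) → proj₂ F⊆U e ; (inj₂ (e , _)) → e })

    F⊆F⁺ : Subgraph F F⁺
    F⊆F⁺ = inj₁ , inj₁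

    p-edge : ∀ {v w} → v ∈ vertices p → w ∈ vertices p → E K v w → E F⁺ v w
    p-edge v∈p w∈p e = inj₂ (proj₂ K⊆U e , inj₂ v∈p , inj₂ w∈p)

    alongP : ∀ {a b} (q : Path K a b) → Within (_∈ vertices p) q → Path F⁺ a b
    alongP = transport (_∈ vertices p) inj₂ p-edge

    alongP-avoiding : ∀ {x a b} (q : Path K a b) → Within (OnAvoiding p x) q → Path (F⁺ ─ x) a b
    alongP-avoiding {x} = transport (OnAvoiding p x)
      (λ (v∈p , v≢x) → inj₂ v∈p , v≢x)
      (λ (v∈p , v≢x) (w∈p , w≢x) e → p-edge v∈p w∈p e , v≢x , w≢x)

    toStart : ∀ {v} → InF⁺ v → Path F⁺ v u
    toStart (inj₁ vF) = mapPath F⊆F⁺ (F-joined vF uF)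
    toStart (inj₂ v∈p) =
      let (q , q⊆p , _) = suffix p v∈p
      in alongP q q⊆p ++ᵖ mapPath F⊆F⁺ (F-joined tF uF)

    F⁺-connected : Connected F⁺
    F⁺-connected = (u , inj₁ uF) , λ a∈ b∈ → toStart a∈ ++ᵖ reverse (toStart b∈)

    anchor : ∀ {x c} → V (F⁺ ─ x) c → Σ[ d ∈ ℕ ] V (F ─ x) d × Path (F⁺ ─ x) c d
    anchor (inj₁ cF , c≢x) = _ , (cF , c≢x) , here (inj₁ cF , c≢x)
    anchor {x} (inj₂ c∈p , c≢x) with avoid x p simple c∈p c≢x
    ... | inj₁ (q , ok) = let q′ = alongP-avoiding q ok
                          in t , (tF , proj₂ (endVertex q′)) , q′
    ... | inj₂ (q , ok) = let q′ = alongP-avoiding q ok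
                          in u , (uF , proj₂ (startVertex q′)) , reverse q′

    liftF-avoiding : ∀ {x a b} → Path (F ─ x) a b → Path (F⁺ ─ x) a b
    liftF-avoiding = mapPath (─-mono {A = F} {B = F⁺} F⊆F⁺)

    -- Vertices of F − x cannot be separated in F⁺ − x, since F has no
    -- cut vertex (a classical case split on whether x lies in F).
    inseparable : ∀ {x c d} → V (F ─ x) c → V (F ─ x) d → ¬ ¬ Path (F⁺ ─ x) c d
    inseparable {x} {c} {d} (cF , c≢x) (dF , d≢x) noPath = ¬¬-excluded-middle {A = V F x} λ
      { (yes xF) → F-noCut x (xF , c , d , (cF , c≢x) , (dF , d≢x) , noPath ∘ liftF-avoiding)
      ; (no x∉F) → noPath (liftF-avoiding (mapPath (─-absent {G = F} x∉F) (F-joined cF dF))) }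

    -- Two vertices of F⁺ − x reach F − x, where they cannot be separated.
    F⁺-noCut : ∀ x → ¬ IsCutVertex F⁺ x
    F⁺-noCut x (_ , _ , _ , a∈ , b∈ , noPath) =
      let (_ , c∈ , ac) = anchor a∈
          (_ , d∈ , bd) = anchor b∈
      in inseparable c∈ d∈ λ cd → noPath (ac ++ᵖ cd ++ᵖ reverse bd)

    F⁺⊆F : Subgraph F⁺ F
    F⁺⊆F = F-maximal F⁺ F⁺⊆U (F⁺-connected , F⁺-noCut) F⊆F⁺

    -- By maximality F⁺ = F, so p is a walk of F ∩ K.
    p-in-block : Path (F ∩ᴳ K) u t
    p-in-block = transport (_∈ vertices p)
      (λ v∈p → proj₁ F⁺⊆F (inj₂ v∈p) , ∈vertices⇒V p v∈p)
      (λ v∈p w∈p e → proj₂ F⁺⊆F (p-edge v∈p w∈p e) , e)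
      p (λ v∈p → v∈p)

  walk-in-block : ∀ {K} → Subgraph K U → ∀ {a b} → Path K a b → V F a → V F b →
    Path (F ∩ᴳ K) a b
  walk-in-block K⊆U q aF bF =
    let (p , simple) = simplify q in Extension.p-in-block K⊆U p simple aF bF

record PathClosed (G′ H′ : Graph) (S′ : VSet) (G H : Graph) (S : VSet) : Set where
  field
    G′⊆G  : Subgraph G′ G
    H′⊆H  : Subgraph H′ H
    S′⊆S  : S′ ⊆ S
    liftG : ∀ {a b} → S′ a → S′ b → Path G a b → Path G′ a b
    liftH : ∀ {a b} → S′ a → S′ b → Path H a b → Path H′ a b
    liftS : ∀ {a b} → S′ a → S′ b → Path (G [ S ]) a b → Path (G′ [ S′ ]) a b

module _ {G′ H′ G H : Graph} {S′ S : VSet} (closed : PathClosed G′ H′ S′ G H S) where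
  open PathClosed closed

  adj-restrict : ∀ y z → AuxAdj G′ H′ S′ y z → AuxAdj G H S y z
  adj-restrict (X₁ _) (Y _) (s∈ , p) = S′⊆S s∈ , mapPath G′⊆G p
  adj-restrict (X₂ _) (Y _) (s∈ , p) = S′⊆S s∈ , mapPath H′⊆H p
  adj-restrict (Y _) (X₁ _) (s∈ , p) = S′⊆S s∈ , mapPath G′⊆G p
  adj-restrict (Y _) (X₂ _) (s∈ , p) = S′⊆S s∈ , mapPath H′⊆H p

  Anchored : AuxV → Set
  Anchored (X₁ a) = Σ[ s ∈ ℕ ] S′ s × Path G′ a s
  Anchored (X₂ a) = Σ[ s ∈ ℕ ] S′ s × Path H′ a s
  Anchored (Y s)  = S′ s

  adj⇒anchored : ∀ y z → AuxAdj G′ H′ S′ y z → Anchored y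
  adj⇒anchored (X₁ _) (Y s) (s∈ , p) = s , s∈ , p
  adj⇒anchored (X₂ _) (Y s) (s∈ , p) = s , s∈ , p
  adj⇒anchored (Y _) (X₁ _) (s∈ , _) = s∈
  adj⇒anchored (Y _) (X₂ _) (s∈ , _) = s∈

  rejoin : ∀ {A′ A : Graph} → Subgraph A′ A →
    (∀ {a b} → S′ a → S′ b → Path A a b → Path A′ a b) →
    ∀ {a b} → Σ[ s ∈ ℕ ] S′ s × Path A′ a s → Σ[ t ∈ ℕ ] S′ t × Path A′ b t →
    Path A a b → Path A′ a b
  rejoin A′⊆A lift (_ , s∈ , as) (_ , t∈ , bt) ab =
    as ++ᵖ lift s∈ t∈ (reverse (mapPath A′⊆A as) ++ᵖ ab ++ᵖ mapPath A′⊆A bt) ++ᵖ reverse bt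

  eq-reflect : ∀ y z → Anchored y → Anchored z → AuxEq G H S y z → AuxEq G′ H′ S′ y z
  eq-reflect (X₁ _) (X₁ _) ay az = rejoin G′⊆G liftG ay az
  eq-reflect (X₂ _) (X₂ _) ay az = rejoin H′⊆H liftH ay az
  eq-reflect (Y _)  (Y _)  ay az = liftS ay az
  eq-reflect (X₁ _) (X₂ _) _ _ ()
  eq-reflect (X₁ _) (Y _)  _ _ ()
  eq-reflect (X₂ _) (X₁ _) _ _ ()
  eq-reflect (X₂ _) (Y _)  _ _ ()
  eq-reflect (Y _)  (X₁ _) _ _ ()
  eq-reflect (Y _)  (X₂ _) _ _ ()

  acyclic-restrict : AuxAcyclic G H S → AuxAcyclic G′ H′ S′
  acyclic-restrict acyclic (k , c , 3≤k , adj , adjLast , distinct) =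
    acyclic (k , c , 3≤k
            , (λ i i< → adj-restrict _ _ (adj i i<))
            , adj-restrict _ _ adjLast
            , λ i j i< j< eq → distinct i j i< j< (eq-reflect _ _ (onCycle i i<) (onCycle j j<) eq))
    where
    onCycle : ∀ i → i < k → Anchored (c i)
    onCycle i i< with suc i <? k
    ... | yes i+1< = adj⇒anchored _ _ (adj i i+1<)
    ... | no i+1≮ = adj⇒anchored _ _
      (subst (λ m → AuxAdj G′ H′ S′ (c (m ∸ 1)) (c 0)) (sym (≤-antisym i< (≮⇒≥ i+1≮))) adjLast)

block-restriction : ∀ {G H F : Graph} {S : VSet} → IsBlock F (G ∪ᴳ H) →
  PathClosed (F ∩ᴳ G) (F ∩ᴳ H) (S ∩ˢ V F) G H S
block-restriction {G} {H} {F} {S} block = record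
  { G′⊆G  = proj₂ , proj₂
  ; H′⊆H  = proj₂ , proj₂
  ; S′⊆S  = proj₁
  ; liftG = λ (_ , aF) (_ , bF) p → walk-in-block (inj₁ , inj₁) p aF bF
  ; liftH = λ (_ , aF) (_ , bF) p → walk-in-block (inj₂ , inj₂) p aF bF
  ; liftS = λ (_ , aF) (_ , bF) p →
      mapPath (∩-induced {F} {G} {S}) (walk-in-block (inj₁ ∘ proj₁ , inj₁ ∘ proj₁) p aF bF)
  }
  where open BlockAbsorption {U = G ∪ᴳ H} {F = F} block using (walk-in-block)

lemma3p6 : (d : ℕ) (G H : Graph) (S : VSet) (LG LH : ℕ → Fin d) →
    Finite G → Finite H →
    IsBlockLabeling d G LG → IsBlockLabeling d H LH →
    Compatible d G LG H LH S →
    AuxAcyclic G H S →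
    (F : Graph) → IsSBlock F S (G ∪ᴳ H) →
    AuxAcyclic (F ∩ᴳ G) (F ∩ᴳ H) (S ∩ˢ V F)
lemma3p6 _ G H S _ _ _ _ _ _ _ acyclic F (block , _) =
  acyclic-restrict (block-restriction {G} {H} {F} {S} block) acyclic
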